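{- Let $M=(\Omega,P)$ be a canonical partially observable Markov chain with sink $s$, let $a,b\in\Omega$, and let $\mathcal{P}$ be a partition of $\Omega$ that refines $\{\Omega\setminus\{s\},\{s\}\}$ and does not separate $a$ and $b$ (i.e. $\mathcal{P}(a)=\mathcal{P}(b)$). Let $$\theta(\mathcal{P})=\max_{x,y:\ \mathcal{P}(x)=\mathcal{P}(y)} d^{\mathcal{P}}_{TV}(x,y).$$ Then any (possibly adaptive) rewinding strategy that uses $Q$ queries, together with any rule for outputting $a$ or $b$ from the observations, distinguishes between initial states $a$ and $b$ with success probability at most $\frac12+\frac{Q\,\theta(\mathcal{P})}{2}$ (that is, for at least one of $X_0=a$, $X_0=b$ the output is correct with probability at most $\frac12+\frac{Q\theta(\mathcal{P})}{2}$).
   Context: A canonical partially observable Markov chain $M=(\Omega,P)$ has finite state space $\Omega$, transition probabilities $P$ (from state $y$ the next state is drawn from $P(\cdot\mid y)$), a sink state $s$ with $P(s\mid s)=1$, and observation $O(x)=1$ if $x=s$, $O(x)=0$ otherwise; states are hidden and only observations are visible. A rewinding strategy, starting from the hidden initial state $X_0$, repeatedly chooses (possibly based on past observations) a previously generated state and draws a fresh next state from it according to $P$, independently of all other draws given the chosen state; each draw is a query. For a partition $\mathcal{P}$ of $\Omega$, $\mathcal{P}(x)$ is the class of $x$; $\mathcal{P}$ refines $\mathcal{P}'$ if each class of $\mathcal{P}$ lies within a class of $\mathcal{P}'$. Writing $p(x,C)=\sum_{y\in C}P(y\mid x)$, $d^{\mathcal{P}}_{TV}(x,y)=\frac12\s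um_{C\in\mathcal{P}}|p(x,C)-p(y,C)|$.
   Formalization: The transition probabilities P(y|x) are rational, and a randomized strategy is taken as a mixture of deterministic strategies with rational weights. -}

module Defs where

open import Data.Nat using (ℕ; zero; suc)
open import Data.Fin using (Fin; zero; suc)
open import Data.Fin.Properties using (_≟_)
open import Data.Bool using (Bool; true; false; if_then_else_)
open import Data.List using (List; []; _∷_; foldr; map; concatMap)
open import Data.List.Base using (allFin)
open import Data.Vec using (Vec; []; _∷_; lookup)
open import Data.Product using (_×_; _,_; proj₁; proj₂)
open import Data.List.Membership.Propositional using (_∈_)
open import Data.Integer using (+_)
open import Data.Rational using (ℚ; 0ℚ; 1ℚ; ½; _+_; _*_; _-_; _≤_; ∣_∣; _⊔_; _/_)
open import Relation.Nullary using (does)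
open import Relation.Binary.PropositionalEquality using (_≡_)

Σℚ : {n : ℕ} → (Fin n → ℚ) → ℚ
Σℚ {n} f = foldr (λ i acc → f i + acc) 0ℚ (allFin n)

sumℚ : List ℚ → ℚ
sumℚ = foldr _+_ 0ℚ

maxℚ : List ℚ → ℚ
maxℚ = foldr _⊔_ 0ℚ

ℕ→ℚ : ℕ → ℚ
ℕ→ℚ k = + k / 1

-- Transition kernel on Ω = Fin n: P x y = P(y | x).
Kernel : ℕ → Set
Kernel n = Fin n → Fin n → ℚ

IsStochastic : {n : ℕ} → Kernel n → Set
IsStochastic {n} P = (∀ x y → 0ℚ ≤ P x y) × (∀ x → Σℚ (P x) ≡ 1ℚ)

record CanonicalPOMC (n : ℕ) : Set where
  field
    P          : Kernel n
    stochastic : IsStochastic P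
    s          : Fin n
    sink       : P s s ≡ 1ℚ

obs : {n : ℕ} → Fin n → Fin n → Bool
obs s x = does (x ≟ s)

-- A partition of Fin n is given by a class-label map c : Fin n → Fin k;
-- the classes are the (nonempty) fibres of c.  P(x) = P(y) iff c x ≡ c y.
-- p(x,C) for the class with label j:
pClass : {n k : ℕ} → Kernel n → (Fin n → Fin k) → Fin n → Fin k → ℚ
pClass P c x j = Σℚ (λ y → if does (c y ≟ j) then P x y else 0ℚ)

-- d^P_TV(x,y) = 1/2 Σ_C |p(x,C) - p(y,C)|  (empty labels contribute 0).
dTV : {n k : ℕ} → Kernel n → (Fin n → Fin k) → Fin n → Fin n → ℚ
dTV P c x y = ½ * Σℚ (λ j → ∣ pClass P c x j - pClass P c y j ∣)

θ : {n k : ℕ} → Kernel n → (Fin n → Fin k) → ℚ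
θ {n} P c = maxℚ (concatMap (λ x → concatMap (λ y →
  if does (c x ≟ c y) then dTV P c x y ∷ [] else []) (allFin n)) (allFin n))

-- Strat n m q : m states generated so far (stored in a vector, most recent
-- first), q queries still to make.  A query picks one of the m generated
-- states; the new state is drawn from P(·| chosen), and the strategy continues
-- depending on its observation.  After all queries an output bit is produced
-- (true = "a", false = "b"); the output may depend on all observations since
-- they are encoded by the path in the tree.
data Strat : ℕ → ℕ → Set where
  done  : {m : ℕ} → Bool → Strat m 0
  query : {m q : ℕ} → Fin m → (Bool → Strat (suc m) q) → Strat m (suc q)

probTrue : {n m q : ℕ} → Kernel n → Fin n → Strat m q → Vec (Fin n) m → ℚ
probTrue P s (done b)    xs = if b then 1ℚ else 0ℚ
probTrue P s (query i k) xs =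
  Σℚ (λ y → P (lookup xs i) y * probTrue P s (k (obs s y)) (y ∷ xs))

-- A deterministic strategy with Q queries, starting from the observation of X₀.
DetStrategy : ℕ → Set
DetStrategy Q = Bool → Strat 1 Q

probTrueFrom : {n Q : ℕ} → Kernel n → Fin n → DetStrategy Q → Fin n → ℚ
probTrueFrom P s σ x₀ = probTrue P s (σ (obs s x₀)) (x₀ ∷ [])

-- A (possibly randomized) strategy: a finite mixture of deterministic ones
-- (internal randomness can be sampled up front).
record Strategy (Q : ℕ) : Set where
  field
    mixture  : List (ℚ × DetStrategy Q)
    weights≥0 : ∀ {w σ} → (w , σ) ∈ mixture → 0ℚ ≤ w
    weights=1 : sumℚ (map proj₁ mixture) ≡ 1ℚ

probA : {n Q : ℕ} → Kernel n → Fin n → Strategy Q → Fin n → ℚ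
probA P s σ x₀ = sumℚ (map (λ p → proj₁ p * probTrueFrom P s (proj₂ p) x₀) (Strategy.mixture σ))

successA : {n Q : ℕ} → Kernel n → Fin n → Strategy Q → Fin n → ℚ
successA P s σ a = probA P s σ a

successB : {n Q : ℕ} → Kernel n → Fin n → Strategy Q → Fin n → ℚ
successB P s σ b = 1ℚ - probA P s σ b

-- Run the strategy from a and from b side by side.  As a and b lie in one class, each
-- query is made at two states of a common class, and the two next states can be coupled
-- to fall into a common class except with probability at most θ; since the sink is
-- alone in its class, coupled runs see the same observations.  Without couplings this
-- is an induction over the strategy tree whose step is E_p f ≤ E_r g + d_TV(p, r) for
-- 0 ≤ f ≤ 1 with f ≤ g on each class: the class-wise maximum of f lies in [0, 1] and
-- separates f from g.  Thus P_a(output a) ≤ P_b(output a) + Qθ, so the two success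
-- probabilities sum to at most 1 + Qθ.

module Submission where

open import Defs
open import Algebra.Bundles using (Ring)
open import Data.Nat using (ℕ; zero; suc)
import Data.Nat.Coprimality as Coprimality
open import Data.Fin using (Fin; zero; suc)
open import Data.Fin.Properties using (_≟_)
open import Data.Empty using (⊥-elim)
open import Data.Sum using (_⊎_; inj₁; inj₂)
open import Data.Bool using (Bool; true; false; if_then_else_)
open import Data.List using (List; []; _∷_; foldr; map; filter; concatMap; tabulate; allFin)
open import Data.List.Membership.Propositional using (_∈_; lose)
open import Data.List.Membership.Propositional.Properties
  using (∈-map⁺; ∈-map⁻; ∈-filter⁺; ∈-filter⁻; ∈-allFin; ∈-concatMap⁺)
open import Data.List.Relation.Unary.Any using (here; there)
open import Data.Vec using ([]; _∷_; lookup)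
open import Data.Vec.Relation.Binary.Pointwise.Inductive as Pointwise using (Pointwise; []; _∷_)
open import Data.Product using (_×_; _,_; proj₁; proj₂)
import Data.Integer.Base as ℤ using (+_; _+_)
import Data.Integer.Properties as ℤ
open import Data.Rational using (ℚ; mkℚ; 0ℚ; 1ℚ; ½; _+_; _*_; _-_; ∣_∣; _≤_; _/_; nonNegative)
import Data.Rational.Properties as ℚ
open import Data.Rational.Solver using (module +-*-Solver)
open import Algebra.Properties.Semiring.Sum (Ring.semiring ℚ.+-*-ring)
  using (sum; ∑-distrib-+; ∑-comm; *-distribˡ-sum; *-distribʳ-sum; sum-cong-≗; sum-replicate-zero)
open import Function using (id; _∘_; _on_)
open import Relation.Binary.PropositionalEquality using (_≡_; refl; sym; trans; cong; cong₂; subst)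
open import Relation.Nullary using (yes; no; does)
open import Relation.Nullary.Decidable using (dec-true)

open +-*-Solver
open ℚ.≤-Reasoning

Σℚ≡sum : ∀ {n} (f : Fin n → ℚ) → Σℚ f ≡ sum f
Σℚ≡sum {n} f = foldr-tabulate id
  where
  foldr-tabulate : ∀ {m} (h : Fin m → Fin n) →
    foldr (λ i acc → f i + acc) 0ℚ (tabulate h) ≡ sum (f ∘ h)
  foldr-tabulate {zero}  h = refl
  foldr-tabulate {suc m} h = cong (f (h zero) +_) (foldr-tabulate (h ∘ suc))

sum-mono-≤ : ∀ {n} {f g : Fin n → ℚ} → (∀ i → f i ≤ g i) → sum f ≤ sum g
sum-mono-≤ {zero}  _   = ℚ.≤-refl
sum-mono-≤ {suc n} f≤g = ℚ.+-mono-≤ (f≤g zero) (sum-mono-≤ (f≤g ∘ suc))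

sum-*-monoˡ-≤ : ∀ {n} {p f g : Fin n → ℚ} → (∀ i → 0ℚ ≤ p i) → (∀ i → f i ≤ g i) →
  sum (λ i → p i * f i) ≤ sum (λ i → p i * g i)
sum-*-monoˡ-≤ {p = p} p≥0 f≤g =
  sum-mono-≤ (λ i → ℚ.*-monoˡ-≤-nonNeg (p i) {{nonNegative (p≥0 i)}} (f≤g i))

∑-distrib-- : ∀ {n} (f g : Fin n → ℚ) → sum (λ i → f i - g i) ≡ sum f - sum g
∑-distrib-- {zero}  f g = refl
∑-distrib-- {suc n} f g =
  trans (cong (f zero - g zero +_) (∑-distrib-- (f ∘ suc) (g ∘ suc)))
        (solve 4 (λ a b c d → (a :- b) :+ (c :- d) := (a :+ c) :- (b :+ d)) refl
               (f zero) (g zero) (sum (f ∘ suc)) (sum (g ∘ suc)))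

sum-*-+-const : ∀ {n} {p : Fin n → ℚ} (g : Fin n → ℚ) ε → sum p ≡ 1ℚ →
  sum (λ i → p i * (g i + ε)) ≡ sum (λ i → p i * g i) + ε
sum-*-+-const {p = p} g ε Σp≡1 = begin-equality
  sum (λ i → p i * (g i + ε))            ≡⟨ sum-cong-≗ (λ i → ℚ.*-distribˡ-+ (p i) (g i) ε) ⟩
  sum (λ i → p i * g i + p i * ε)        ≡⟨ ∑-distrib-+ (λ i → p i * g i) (λ i → p i * ε) ⟩
  sum (λ i → p i * g i) + sum (λ i → p i * ε)
    ≡⟨ cong (sum (λ i → p i * g i) +_) (*-distribʳ-sum ε p) ⟨
  sum (λ i → p i * g i) + sum p * ε      ≡⟨ cong (λ x → sum (λ i → p i * g i) + x * ε) Σp≡1 ⟩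
  sum (λ i → p i * g i) + 1ℚ * ε         ≡⟨ cong (sum (λ i → p i * g i) +_) (ℚ.*-identityˡ ε) ⟩
  sum (λ i → p i * g i) + ε              ∎

if-then-0-* : ∀ (b : Bool) u v → (if b then u else 0ℚ) * v ≡ (if b then u * v else 0ℚ)
if-then-0-* true  u v = refl
if-then-0-* false u v = ℚ.*-zeroˡ v

sum-indicator : ∀ {k} (i : Fin k) (F : Fin k → ℚ) →
  sum (λ j → if does (i ≟ j) then F j else 0ℚ) ≡ F i
sum-indicator {suc k} zero    F = trans (cong (F zero +_) (sum-replicate-zero k)) (ℚ.+-identityʳ _)
sum-indicator {suc k} (suc i) F = trans (ℚ.+-identityˡ _) (sum-indicator i (F ∘ suc))

*-≤-½[p+∣p∣] : ∀ t {m} → 0ℚ ≤ m → m ≤ 1ℚ → t * m ≤ ½ * (t + ∣ t ∣)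
*-≤-½[p+∣p∣] t {m} 0≤m m≤1 with ℚ.∣p∣≡p∨∣p∣≡-p t
... | inj₁ ∣t∣≡t = begin
  t * m          ≤⟨ ℚ.*-monoˡ-≤-nonNeg t {{nonNegative 0≤t}} m≤1 ⟩
  t * 1ℚ         ≡⟨ solve 1 (λ t → t :* con 1ℚ := con ½ :* (t :+ t)) refl t ⟩
  ½ * (t + t)    ≡⟨ cong (λ u → ½ * (t + u)) ∣t∣≡t ⟨
  ½ * (t + ∣ t ∣) ∎
  where
  0≤t : 0ℚ ≤ t
  0≤t = subst (0ℚ ≤_) ∣t∣≡t (ℚ.0≤∣p∣ t)
... | inj₂ ∣t∣≡-t = begin
  t * m           ≤⟨ ℚ.*-monoʳ-≤-nonNeg m {{nonNegative 0≤m}} t≤0 ⟩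
  0ℚ * m          ≡⟨ solve 2 (λ t m → con 0ℚ :* m := con ½ :* (t :- t)) refl t m ⟩
  ½ * (t - t)     ≡⟨ cong (λ u → ½ * (t + u)) ∣t∣≡-t ⟨
  ½ * (t + ∣ t ∣) ∎
  where
  t≤0 : t ≤ 0ℚ
  t≤0 = subst (_≤ 0ℚ) (solve 1 (λ t → :- (:- t) := t) refl t)
          (ℚ.neg-antimono-≤ (subst (0ℚ ≤_) ∣t∣≡-t (ℚ.0≤∣p∣ t)))

sum-*-≤-+-½∑∣-∣ : ∀ {k} (α β m : Fin k → ℚ) → sum α ≡ sum β →
  (∀ j → 0ℚ ≤ m j) → (∀ j → m j ≤ 1ℚ) →
  sum (λ j → α j * m j) ≤ sum (λ j → β j * m j) + ½ * sum (λ j → ∣ α j - β j ∣)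
sum-*-≤-+-½∑∣-∣ α β m Σα≡Σβ 0≤m m≤1 = begin
  sum (λ j → α j * m j)
    ≡⟨ sum-cong-≗ (λ j → solve 3 (λ a b x → a :* x := b :* x :+ (a :- b) :* x) refl (α j) (β j) (m j)) ⟩
  sum (λ j → β j * m j + δ j * m j)
    ≡⟨ ∑-distrib-+ (λ j → β j * m j) (λ j → δ j * m j) ⟩
  sum (λ j → β j * m j) + sum (λ j → δ j * m j)
    ≤⟨ ℚ.+-monoʳ-≤ (sum (λ j → β j * m j)) (sum-mono-≤ (λ j → *-≤-½[p+∣p∣] (δ j) (0≤m j) (m≤1 j))) ⟩
  sum (λ j → β j * m j) + sum (λ j → ½ * (δ j + ∣ δ j ∣))
    ≡⟨ cong (sum (λ j → β j * m j) +_) ½∑[δ+∣δ∣]≡½∑∣δ∣ ⟩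
  sum (λ j → β j * m j) + ½ * sum (λ j → ∣ δ j ∣) ∎
  where
  δ : _ → ℚ
  δ j = α j - β j
  ½∑[δ+∣δ∣]≡½∑∣δ∣ : sum (λ j → ½ * (δ j + ∣ δ j ∣)) ≡ ½ * sum (λ j → ∣ δ j ∣)
  ½∑[δ+∣δ∣]≡½∑∣δ∣ = begin-equality
    sum (λ j → ½ * (δ j + ∣ δ j ∣))     ≡⟨ *-distribˡ-sum ½ (λ j → δ j + ∣ δ j ∣) ⟨
    ½ * sum (λ j → δ j + ∣ δ j ∣)       ≡⟨ cong (½ *_) (∑-distrib-+ δ (λ j → ∣ δ j ∣)) ⟩
    ½ * (sum δ + sum (λ j → ∣ δ j ∣))   ≡⟨ cong (λ x → ½ * (x + sum (λ j → ∣ δ j ∣))) ∑δ≡0 ⟩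
    ½ * (0ℚ + sum (λ j → ∣ δ j ∣))      ≡⟨ cong (½ *_) (ℚ.+-identityˡ (sum (λ j → ∣ δ j ∣))) ⟩
    ½ * sum (λ j → ∣ δ j ∣)             ∎
    where
    ∑δ≡0 : sum δ ≡ 0ℚ
    ∑δ≡0 = trans (∑-distrib-- α β) (trans (cong (_- sum β) Σα≡Σβ) (ℚ.+-inverseʳ (sum β)))

0≤maxℚ : ∀ l → 0ℚ ≤ maxℚ l
0≤maxℚ []      = ℚ.≤-refl
0≤maxℚ (x ∷ l) = ℚ.≤-trans (0≤maxℚ l) (ℚ.p≤q⊔p x (maxℚ l))

maxℚ-upper : ∀ {x l} → x ∈ l → x ≤ maxℚ l
maxℚ-upper {x} {_ ∷ l} (here refl) = ℚ.p≤p⊔q x (maxℚ l)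
maxℚ-upper {x} {y ∷ l} (there x∈l) = ℚ.≤-trans (maxℚ-upper x∈l) (ℚ.p≤q⊔p y (maxℚ l))

maxℚ-lub : ∀ {l B} → 0ℚ ≤ B → (∀ {x} → x ∈ l → x ≤ B) → maxℚ l ≤ B
maxℚ-lub {[]}    0≤B _   = 0≤B
maxℚ-lub {x ∷ l} 0≤B l≤B = ℚ.⊔-lub (l≤B (here refl)) (maxℚ-lub 0≤B (l≤B ∘ there))

classMass : ∀ {n k} → (Fin n → Fin k) → (Fin n → ℚ) → Fin k → ℚ
classMass c p j = Σℚ (λ z → if does (c z ≟ j) then p z else 0ℚ)

sum-classMass-* : ∀ {n k} (c : Fin n → Fin k) (p : Fin n → ℚ) (h : Fin k → ℚ) →
  sum (λ j → classMass c p j * h j) ≡ sum (λ z → p z * h (c z))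
sum-classMass-* c p h = begin-equality
  sum (λ j → classMass c p j * h j)
    ≡⟨ sum-cong-≗ (λ j → cong (_* h j) (Σℚ≡sum (mass j))) ⟩
  sum (λ j → sum (mass j) * h j)
    ≡⟨ sum-cong-≗ (λ j → *-distribʳ-sum (h j) (mass j)) ⟩
  sum (λ j → sum (λ z → mass j z * h j))
    ≡⟨ ∑-comm (λ z j → mass j z * h j) ⟨
  sum (λ z → sum (λ j → mass j z * h j))
    ≡⟨ sum-cong-≗ (λ z → trans (sum-cong-≗ (λ j → if-then-0-* (does (c z ≟ j)) (p z) (h j)))
                               (sum-indicator (c z) (λ j → p z * h j))) ⟩
  sum (λ z → p z * h (c z)) ∎
  where
  mass : _ → _ → ℚ
  mass j z = if does (c z ≟ j) then p z else 0ℚ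

sum-classMass : ∀ {n k} (c : Fin n → Fin k) (p : Fin n → ℚ) → sum (classMass c p) ≡ sum p
sum-classMass c p = begin-equality
  sum (classMass c p)                       ≡⟨ sum-cong-≗ (λ j → ℚ.*-identityʳ (classMass c p j)) ⟨
  sum (λ j → classMass c p j * 1ℚ)          ≡⟨ sum-classMass-* c p (λ _ → 1ℚ) ⟩
  sum (λ z → p z * 1ℚ)                      ≡⟨ sum-cong-≗ (λ z → ℚ.*-identityʳ (p z)) ⟩
  sum p                                     ∎

-- maxℚ starts from 0, so classMax is 0 on an empty class and never negative.
classMax : ∀ {n k} → (Fin n → Fin k) → (Fin n → ℚ) → Fin k → ℚ
classMax {n} c f j = maxℚ (map f (filter (λ z → c z ≟ j) (allFin n)))

0≤classMax : ∀ {n k} (c : Fin n → Fin k) (f : Fin n → ℚ) j → 0ℚ ≤ classMax c f j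
0≤classMax {n} c f j = 0≤maxℚ (map f (filter (λ z → c z ≟ j) (allFin n)))

≤-classMax : ∀ {n k} (c : Fin n → Fin k) (f : Fin n → ℚ) z → f z ≤ classMax c f (c z)
≤-classMax c f z = maxℚ-upper (∈-map⁺ f (∈-filter⁺ (λ w → c w ≟ c z) (∈-allFin z) refl))

classMax-lub : ∀ {n k} (c : Fin n → Fin k) (f : Fin n → ℚ) {j B} → 0ℚ ≤ B →
  (∀ z → c z ≡ j → f z ≤ B) → classMax c f j ≤ B
classMax-lub {n} c f {j} {B} 0≤B class≤B = maxℚ-lub 0≤B image≤B
  where
  image≤B : ∀ {x} → x ∈ map f (filter (λ z → c z ≟ j) (allFin n)) → x ≤ B
  image≤B x∈ with ∈-map⁻ f x∈
  ... | z , z∈ , refl = class≤B z (proj₂ (∈-filter⁻ (λ w → c w ≟ j) {xs = allFin n} z∈))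

-- dTV P c x y unfolds to classTV c (P x) (P y).
classTV : ∀ {n k} → (Fin n → Fin k) → (Fin n → ℚ) → (Fin n → ℚ) → ℚ
classTV c p r = ½ * Σℚ (λ j → ∣ classMass c p j - classMass c r j ∣)

sum-*-≤-+-classTV : ∀ {n k} (c : Fin n → Fin k) {p r f g : Fin n → ℚ} →
  (∀ z → 0ℚ ≤ p z) → (∀ z → 0ℚ ≤ r z) → sum p ≡ sum r →
  (∀ z → 0ℚ ≤ f z) → (∀ z → f z ≤ 1ℚ) → (∀ z w → c z ≡ c w → f z ≤ g w) →
  sum (λ z → p z * f z) ≤ sum (λ z → r z * g z) + classTV c p r
sum-*-≤-+-classTV c {p} {r} {f} {g} 0≤p 0≤r Σp≡Σr 0≤f f≤1 f≤g = begin
  sum (λ z → p z * f z)        ≤⟨ sum-*-monoˡ-≤ 0≤p (≤-classMax c f) ⟩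
  sum (λ z → p z * m (c z))    ≡⟨ sum-classMass-* c p m ⟨
  sum (λ j → α j * m j)        ≤⟨ sum-*-≤-+-½∑∣-∣ α β m Σα≡Σβ (0≤classMax c f) m≤1 ⟩
  sum (λ j → β j * m j) + ½ * sum (λ j → ∣ α j - β j ∣)
    ≡⟨ cong₂ (λ x y → x + ½ * y) (sum-classMass-* c r m) (sym (Σℚ≡sum (λ j → ∣ α j - β j ∣))) ⟩
  sum (λ z → r z * m (c z)) + classTV c p r
    ≤⟨ ℚ.+-monoˡ-≤ (classTV c p r) (sum-*-monoˡ-≤ 0≤r m∘c≤g) ⟩
  sum (λ z → r z * g z) + classTV c p r ∎
  where
  m α β : _ → ℚ
  m = classMax c f
  α = classMass c p
  β = classMass c r
  Σα≡Σβ : sum α ≡ sum β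
  Σα≡Σβ = trans (sum-classMass c p) (trans Σp≡Σr (sym (sum-classMass c r)))
  m≤1 : ∀ j → m j ≤ 1ℚ
  m≤1 j = classMax-lub c f (ℚ.nonNegative⁻¹ 1ℚ) (λ z _ → f≤1 z)
  m∘c≤g : ∀ w → m (c w) ≤ g w
  m∘c≤g w = classMax-lub c f (ℚ.≤-trans (0≤f w) (f≤g w w refl)) (λ z cz≡cw → f≤g z w cz≡cw)

ℕ→ℚ-suc : ∀ q → ℕ→ℚ (suc q) ≡ 1ℚ + ℕ→ℚ q
ℕ→ℚ-suc q = begin-equality
  ℤ.+ suc q / 1         ≡⟨ ℚ./-cong (cong (ℤ._+_ (ℤ.+ 1)) (ℤ.*-identityʳ (ℤ.+ q))) refl ⟨
  1ℚ + mkℚ (ℤ.+ q) 0 q⊥1 ≡⟨ cong (1ℚ +_) (ℚ.normalize-coprime q⊥1) ⟨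
  1ℚ + ℕ→ℚ q            ∎
  where q⊥1 = Coprimality.sym (Coprimality.1-coprimeTo q)

ℕ→ℚ-suc-* : ∀ q t → ℕ→ℚ (suc q) * t ≡ ℕ→ℚ q * t + t
ℕ→ℚ-suc-* q t = begin-equality
  ℕ→ℚ (suc q) * t         ≡⟨ cong (_* t) (ℕ→ℚ-suc q) ⟩
  (1ℚ + ℕ→ℚ q) * t        ≡⟨ solve 2 (λ x t → (con 1ℚ :+ x) :* t := x :* t :+ t) refl (ℕ→ℚ q) t ⟩
  ℕ→ℚ q * t + t           ∎

dTV≤θ : ∀ {n k} (P : Kernel n) (c : Fin n → Fin k) {x y} → c x ≡ c y → dTV P c x y ≤ θ P c
dTV≤θ {n} P c {x} {y} cx≡cy =
  maxℚ-upper (∈-concatMap⁺ row (lose (∈-allFin x) (∈-concatMap⁺ (entry x) (lose (∈-allFin y) dTV∈entry))))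
  where
  entry : Fin n → Fin n → List ℚ
  entry x′ y′ = if does (c x′ ≟ c y′) then dTV P c x′ y′ ∷ [] else []
  row : Fin n → List ℚ
  row x′ = concatMap (entry x′) (allFin n)
  dTV∈entry : dTV P c x y ∈ entry x y
  dTV∈entry rewrite dec-true (c x ≟ c y) cx≡cy = here refl

obs-cong : ∀ {n k} (c : Fin n → Fin k) {s} → (∀ x → c x ≡ c s → x ≡ s) →
  ∀ {z w} → c z ≡ c w → obs s z ≡ obs s w
obs-cong c {s} sink-alone {z} {w} cz≡cw with z ≟ s | w ≟ s
... | yes _   | yes _   = refl
... | no  _   | no  _   = refl
... | yes z≡s | no  w≢s = ⊥-elim (w≢s (sink-alone w (trans (sym cz≡cw) (cong c z≡s))))
... | no  z≢s | yes w≡s = ⊥-elim (z≢s (sink-alone z (trans cz≡cw (cong c w≡s))))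

module _ {n} {P : Kernel n} (stochastic : IsStochastic P) (s : Fin n) where

  private
    0≤P : ∀ x y → 0ℚ ≤ P x y
    0≤P = proj₁ stochastic
    sum-P≡1 : ∀ x → sum (P x) ≡ 1ℚ
    sum-P≡1 x = trans (sym (Σℚ≡sum (P x))) (proj₂ stochastic x)

  0≤probTrue : ∀ {m q} (σ : Strat m q) xs → 0ℚ ≤ probTrue P s σ xs
  0≤probTrue (done true)  xs = ℚ.nonNegative⁻¹ 1ℚ
  0≤probTrue (done false) xs = ℚ.≤-refl
  0≤probTrue (query i κ)  xs = begin
    0ℚ                          ≡⟨ ℚ.*-zeroʳ (sum (P x)) ⟨
    sum (P x) * 0ℚ              ≡⟨ *-distribʳ-sum 0ℚ (P x) ⟩
    sum (λ y → P x y * 0ℚ)      ≤⟨ sum-*-monoˡ-≤ (0≤P x) (λ y → 0≤probTrue (κ (obs s y)) (y ∷ xs)) ⟩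
    sum (λ y → P x y * next y)  ≡⟨ Σℚ≡sum (λ y → P x y * next y) ⟨
    probTrue P s (query i κ) xs ∎
    where
    x = lookup xs i
    next : Fin n → ℚ
    next y = probTrue P s (κ (obs s y)) (y ∷ xs)

  probTrue≤1 : ∀ {m q} (σ : Strat m q) xs → probTrue P s σ xs ≤ 1ℚ
  probTrue≤1 (done true)  xs = ℚ.≤-refl
  probTrue≤1 (done false) xs = ℚ.nonNegative⁻¹ 1ℚ
  probTrue≤1 (query i κ)  xs = begin
    probTrue P s (query i κ) xs ≡⟨ Σℚ≡sum (λ y → P x y * next y) ⟩
    sum (λ y → P x y * next y)  ≤⟨ sum-*-monoˡ-≤ (0≤P x) (λ y → probTrue≤1 (κ (obs s y)) (y ∷ xs)) ⟩
    sum (λ y → P x y * 1ℚ)      ≡⟨ *-distribʳ-sum 1ℚ (P x) ⟨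
    sum (P x) * 1ℚ              ≡⟨ cong (_* 1ℚ) (sum-P≡1 x) ⟩
    1ℚ                          ∎
    where
    x = lookup xs i
    next : Fin n → ℚ
    next y = probTrue P s (κ (obs s y)) (y ∷ xs)

  module _ {k} (c : Fin n → Fin k) (sink-alone : ∀ x → c x ≡ c s → x ≡ s)
           {t : ℚ} (dTV≤t : ∀ {x y} → c x ≡ c y → dTV P c x y ≤ t) where

    probTrue-classwise-≤ : ∀ {m q} (σ : Strat m q) {xs ys} → Pointwise (_≡_ on c) xs ys →
      probTrue P s σ xs ≤ probTrue P s σ ys + ℕ→ℚ q * t
    probTrue-classwise-≤ (done b) _ =
      ℚ.≤-reflexive (sym (trans (cong (v +_) (ℚ.*-zeroˡ t)) (ℚ.+-identityʳ v)))
      where v = if b then 1ℚ else 0ℚ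
    probTrue-classwise-≤ (query {q = q} i κ) {xs} {ys} xs~ys = begin
      probTrue P s (query i κ) xs                    ≡⟨ Σℚ≡sum (λ z → P x z * f z) ⟩
      sum (λ z → P x z * f z)
        ≤⟨ sum-*-≤-+-classTV c (0≤P x) (0≤P y) (trans (sum-P≡1 x) (sym (sum-P≡1 y)))
             (λ z → 0≤probTrue (κ (obs s z)) (z ∷ xs)) (λ z → probTrue≤1 (κ (obs s z)) (z ∷ xs)) f≤g+ε ⟩
      sum (λ w → P y w * (g w + ε)) + dTV P c x y
        ≤⟨ ℚ.+-monoʳ-≤ (sum (λ w → P y w * (g w + ε))) (dTV≤t (Pointwise.lookup xs~ys i)) ⟩
      sum (λ w → P y w * (g w + ε)) + t              ≡⟨ cong (_+ t) (sum-*-+-const g ε (sum-P≡1 y)) ⟩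
      sum (λ w → P y w * g w) + ε + t                ≡⟨ ℚ.+-assoc (sum (λ w → P y w * g w)) ε t ⟩
      sum (λ w → P y w * g w) + (ε + t)              ≡⟨ cong₂ _+_ (Σℚ≡sum (λ w → P y w * g w)) (ℕ→ℚ-suc-* q t) ⟨
      probTrue P s (query i κ) ys + ℕ→ℚ (suc q) * t  ∎
      where
      x = lookup xs i
      y = lookup ys i
      ε = ℕ→ℚ q * t
      f g : Fin n → ℚ
      f z = probTrue P s (κ (obs s z)) (z ∷ xs)
      g w = probTrue P s (κ (obs s w)) (w ∷ ys)
      f≤g+ε : ∀ z w → c z ≡ c w → f z ≤ g w + ε
      f≤g+ε z w cz≡cw =
        subst (λ o → f z ≤ probTrue P s (κ o) (w ∷ ys) + ε) (obs-cong c sink-alone cz≡cw)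
              (probTrue-classwise-≤ (κ (obs s z)) (cz≡cw ∷ xs~ys))

    probTrueFrom-classwise-≤ : ∀ {Q a b} (τ : DetStrategy Q) → c a ≡ c b →
      probTrueFrom P s τ a ≤ probTrueFrom P s τ b + ℕ→ℚ Q * t
    probTrueFrom-classwise-≤ {a = a} {b} τ ca≡cb =
      subst (λ o → probTrue P s (τ (obs s a)) (a ∷ []) ≤ probTrue P s (τ o) (b ∷ []) + _)
            (obs-cong c sink-alone ca≡cb) (probTrue-classwise-≤ (τ (obs s a)) (ca≡cb ∷ []))

mixture-≤ : ∀ {A : Set} {f g : A → ℚ} {T} (l : List (ℚ × A)) →
  (∀ {w a} → (w , a) ∈ l → 0ℚ ≤ w) → (∀ a → f a ≤ g a + T) →
  sumℚ (map (λ wa → proj₁ wa * f (proj₂ wa)) l)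
    ≤ sumℚ (map (λ wa → proj₁ wa * g (proj₂ wa)) l) + sumℚ (map proj₁ l) * T
mixture-≤ {T = T} [] _ _ = ℚ.≤-reflexive (sym (trans (ℚ.+-identityˡ (0ℚ * T)) (ℚ.*-zeroˡ T)))
mixture-≤ {f = f} {g} {T} ((w , a) ∷ l) 0≤w f≤g+T = begin
  w * f a + F                 ≤⟨ ℚ.+-mono-≤ (ℚ.*-monoˡ-≤-nonNeg w {{nonNegative (0≤w (here refl))}} (f≤g+T a))
                                            (mixture-≤ l (0≤w ∘ there) f≤g+T) ⟩
  w * (g a + T) + (G + W * T) ≡⟨ solve 5 (λ w x T G W → w :* (x :+ T) :+ (G :+ W :* T) := (w :* x :+ G) :+ (w :+ W) :* T)
                                         refl w (g a) T G W ⟩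
  (w * g a + G) + (w + W) * T ∎
  where
  F = sumℚ (map (λ wa → proj₁ wa * f (proj₂ wa)) l)
  G = sumℚ (map (λ wa → proj₁ wa * g (proj₂ wa)) l)
  W = sumℚ (map proj₁ l)

probA-≤ : ∀ {n Q} {P : Kernel n} {s a b T} (σ : Strategy Q) →
  (∀ τ → probTrueFrom P s τ a ≤ probTrueFrom P s τ b + T) → probA P s σ a ≤ probA P s σ b + T
probA-≤ {P = P} {s} {a} {b} {T} σ det≤ = begin
  probA P s σ a                               ≤⟨ mixture-≤ mixture weights≥0 det≤ ⟩
  probA P s σ b + sumℚ (map proj₁ mixture) * T ≡⟨ cong (λ W → probA P s σ b + W * T) weights=1 ⟩
  probA P s σ b + 1ℚ * T                      ≡⟨ cong (probA P s σ b +_) (ℚ.*-identityˡ T) ⟩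
  probA P s σ b + T                           ∎
  where open Strategy σ

x+y≤m+m⇒x≤m⊎y≤m : ∀ {x y m} → x + y ≤ m + m → x ≤ m ⊎ y ≤ m
x+y≤m+m⇒x≤m⊎y≤m {x} {y} {m} x+y≤m+m with x ℚ.≤? m | y ℚ.≤? m
... | yes x≤m | _       = inj₁ x≤m
... | no  _   | yes y≤m = inj₂ y≤m
... | no  x≰m | no  y≰m =
  ⊥-elim (ℚ.<-irrefl refl (ℚ.≤-<-trans x+y≤m+m (ℚ.+-mono-< (ℚ.≰⇒> x≰m) (ℚ.≰⇒> y≰m))))

claim4p6 : {n k : ℕ} (M : CanonicalPOMC n) (a b : Fin n) (c : Fin n → Fin k)
    → (∀ x → c x ≡ c (CanonicalPOMC.s M) → x ≡ CanonicalPOMC.s M)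
    → c a ≡ c b
    → (Q : ℕ) (σ : Strategy Q)
    → (successA (CanonicalPOMC.P M) (CanonicalPOMC.s M) σ a
         ≤ ½ + ℕ→ℚ Q * θ (CanonicalPOMC.P M) c * ½)
      ⊎ (successB (CanonicalPOMC.P M) (CanonicalPOMC.s M) σ b
         ≤ ½ + ℕ→ℚ Q * θ (CanonicalPOMC.P M) c * ½)
claim4p6 M a b c sink-alone ca≡cb Q σ = x+y≤m+m⇒x≤m⊎y≤m (begin
  A + (1ℚ - B)              ≤⟨ ℚ.+-monoˡ-≤ (1ℚ - B) A≤B+T ⟩
  B + T + (1ℚ - B)
    ≡⟨ solve 2 (λ B T → B :+ T :+ (con 1ℚ :- B) := (con ½ :+ T :* con ½) :+ (con ½ :+ T :* con ½)) refl B T ⟩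
  (½ + T * ½) + (½ + T * ½) ∎)
  where
  open CanonicalPOMC M
  T = ℕ→ℚ Q * θ P c
  A = probA P s σ a
  B = probA P s σ b
  A≤B+T : A ≤ B + T
  A≤B+T = probA-≤ σ (λ τ → probTrueFrom-classwise-≤ stochastic s c sink-alone (dTV≤θ P c) τ ca≡cb)
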